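{- Let $k$ be a nonnegative integer. The number of nice order ideals of $M_{2k+1,2k+3}$ that do not contain the element $1$ is $\binom{2k}{k}$.
   Context: For coprime positive integers $s,t$, let $P_{s,t}=\mathbb{N}^+\setminus\{k_1s+k_2t\mid k_1,k_2\in\mathbb{N}\}$ (with $\mathbb N=\{0,1,2,\dots\}$), partially ordered by the reflexive-transitive closure of the cover relation: $x$ covers $y$ iff $x,y\in P_{s,t}$ and $x-y\in\{s,t\}$. $M_{2k+1,2k+3}$ is the subposet of $P_{2k+1,2k+3}$ obtained by removing all $y$ with $y\succeq 2k+2$. An order ideal is a down-closed subset; it is nice if it contains no two elements $x,y$ with $x-y=1$. -}

module Defs where

open import Data.Nat using (ℕ; _+_; _*_; _<_; _≤_)
open import Data.Product using (_×_; ∃₂)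
open import Data.Sum using (_⊎_)
open import Data.List using (List)
open import Data.List.Membership.Propositional using (_∈_; _∉_)
open import Data.List.Relation.Unary.Linked using (Linked)
open import Relation.Nullary using (¬_)
open import Relation.Binary.PropositionalEquality using (_≡_)
open import Relation.Binary.Construct.Closure.ReflexiveTransitive using (Star)

Representable : ℕ → ℕ → ℕ → Set
Representable s t x = ∃₂ λ k₁ k₂ → k₁ * s + k₂ * t ≡ x

InP : ℕ → ℕ → ℕ → Set
InP s t x = (1 ≤ x) × ¬ Representable s t x

Cover : ℕ → ℕ → ℕ → ℕ → Set
Cover s t y x = InP s t x × InP s t y × ((x ≡ y + s) ⊎ (x ≡ y + t))

_≼⟨_,_⟩_ : ℕ → ℕ → ℕ → ℕ → Set
y ≼⟨ s , t ⟩ x = Star (Cover s t) y x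

InM : ℕ → ℕ → Set
InM k y = InP (2 * k + 1) (2 * k + 3) y
        × ¬ ((2 * k + 2) ≼⟨ 2 * k + 1 , 2 * k + 3 ⟩ y)

-- Finite subsets of ℕ are represented canonically by strictly increasing lists.
-- Order ideal of M_{2k+1,2k+3} (subposet with the induced order)
IsOrderIdealM : ℕ → List ℕ → Set
IsOrderIdealM k I =
  Linked _<_ I
  × (∀ {x} → x ∈ I → InM k x)
  × (∀ {x y} → x ∈ I → InM k y → y ≼⟨ 2 * k + 1 , 2 * k + 3 ⟩ x → y ∈ I)

IsNice : List ℕ → Set
IsNice I = ∀ {x y} → x ∈ I → y ∈ I → ¬ (x ≡ y + 1)

Counted : ℕ → List ℕ → Set
Counted k I = IsOrderIdealM k I × IsNice I × (1 ∉ I)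

module Submission where

-- Write s = 2k + 1 and t = s + 2. Every element of M_{s,t} is uniquely x = r s + c with
-- 2 r < c < s (quotient and remainder by s): an even remainder c ≤ 2 r would make x a
-- combination of s and t, an odd one would put x above s + 1. Adding s raises r, adding t
-- raises r and shifts c by 2, and x + 1 lies in the next column. Hence the nice order ideals
-- avoiding 1 are the sets {r s + c | r < e_c} for the height profiles e₁, …, e₂ₖ with e₁ = 0,
-- e_{c+2} ≤ e_c + 1 and no two adjacent nonzero heights. Generating such profiles entry by
-- entry, the number of continuations of length m after a 0 whose next entry is at most cap
-- is (m + cap) C ⌈m/2⌉, by Pascal's rule in cap; for m = 2k and cap = 0 this is (2k) C k.

open import Defs
open import Data.Nat
open import Data.Nat.Properties
open import Data.Nat.DivMod using (m≡m%n+[m/n]*n; m%n<n; m%n≤m)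
open import Data.Nat.Combinatorics using (_C_; nCk+nC[k+1]≡[n+1]C[k+1]; nCk≡nC[n∸k])
open import Data.Product using (_×_; _,_; proj₁; proj₂; map₁; map₂; ∃₂; ∃-syntax)
open import Data.Sum as Sum using (_⊎_; inj₁; inj₂)
open import Data.Empty using (⊥; ⊥-elim)
open import Data.Unit using (⊤; tt)
open import Data.List using (List; []; _∷_; [_]; length; map; _++_; applyUpTo; upTo; filter)
open import Data.List.Properties using (length-++; length-map; length-applyUpTo; map-∘; map-id-local; ∷-injectiveʳ)
open import Data.List.Membership.Propositional using (_∈_; _∉_)
open import Data.List.Membership.Propositional.Properties
  using (∈-map⁺; ∈-map⁻; ∈-++⁺ˡ; ∈-++⁺ʳ; ∈-++⁻; ∈-upTo⁺; ∈-upTo⁻; ∈-filter⁺; ∈-filter⁻)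
open import Data.List.Membership.DecPropositional _≟_ using (_∈?_)
open import Data.List.Relation.Unary.Any using (here; there)
import Data.List.Relation.Unary.All as All
open import Data.List.Relation.Unary.AllPairs as AllPairs using (AllPairs)
open import Data.List.Relation.Unary.Linked using (Linked)
import Data.List.Relation.Unary.Linked.Properties as Linked
open import Data.List.Relation.Unary.Unique.Propositional using (Unique)
import Data.List.Relation.Unary.Unique.Propositional.Properties as Unique
open import Function using (_∘_; id)
open import Function.Bundles using (_⇔_; mk⇔; Equivalence)
open import Relation.Binary.PropositionalEquality hiding ([_])
open import Relation.Nullary using (¬_; Dec; yes; no)
open import Relation.Binary.Construct.Closure.ReflexiveTransitive using (ε; _◅_; _◅◅_)
open import Data.Nat.Tactic.RingSolver using (solve-∀)

nth : List ℕ → ℕ → ℕ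
nth []       _       = 0
nth (a ∷ _)  zero    = a
nth (_ ∷ as) (suc i) = nth as i

nth-beyond : ∀ as {i} → length as ≤ i → nth as i ≡ 0
nth-beyond []       _         = refl
nth-beyond (a ∷ as) (s≤s len≤) = nth-beyond as len≤

nth-applyUpTo : ∀ f n {i} → i < n → nth (applyUpTo f n) i ≡ f i
nth-applyUpTo f (suc n) {zero}  _        = refl
nth-applyUpTo f (suc n) {suc i} (s≤s i<n) = nth-applyUpTo (f ∘ suc) n i<n

nth-ext : ∀ as bs → length as ≡ length bs → (∀ i → nth as i ≡ nth bs i) → as ≡ bs
nth-ext []       []       _   _  = refl
nth-ext (a ∷ as) (b ∷ bs) len eq = cong₂ _∷_ (eq 0) (nth-ext as bs (suc-injective len) (eq ∘ suc))

Linked<-ext : ∀ {xs ys} → Linked _<_ xs → Linked _<_ ys → (∀ {z} → z ∈ xs ⇔ z ∈ ys) → xs ≡ ys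
Linked<-ext xs↗ ys↗ xs≈ys = go (Linked.Linked⇒AllPairs <-trans xs↗) (Linked.Linked⇒AllPairs <-trans ys↗)
  (Equivalence.to xs≈ys) (Equivalence.from xs≈ys)
  where
  go : ∀ {xs ys} → AllPairs _<_ xs → AllPairs _<_ ys →
       (∀ {z} → z ∈ xs → z ∈ ys) → (∀ {z} → z ∈ ys → z ∈ xs) → xs ≡ ys
  go {[]}     {[]}     _ _ _ _ = refl
  go {[]}     {_ ∷ _}  _ _ _ ⊇ with () ← ⊇ (here refl)
  go {_ ∷ _}  {[]}     _ _ ⊆ _ with () ← ⊆ (here refl)
  go {x ∷ xs} {y ∷ ys} (x< AllPairs.∷ xs↗) (y< AllPairs.∷ ys↗) ⊆ ⊇ = cong₂ _∷_ x≡y (go xs↗ ys↗ ⊆′ ⊇′)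
    where
    x≡y : x ≡ y
    x≡y with ⊆ (here refl) | ⊇ (here refl)
    ... | here x≡y   | _          = x≡y
    ... | there _    | here y≡x   = sym y≡x
    ... | there x∈ys | there y∈xs = ⊥-elim (<-asym (All.lookup x< y∈xs) (All.lookup y< x∈ys))
    ⊆′ : ∀ {z} → z ∈ xs → z ∈ ys
    ⊆′ z∈ with ⊆ (there z∈)
    ... | here refl = ⊥-elim (<-irrefl x≡y (All.lookup x< z∈))
    ... | there z∈′ = z∈′
    ⊇′ : ∀ {z} → z ∈ ys → z ∈ xs
    ⊇′ z∈ with ⊇ (there z∈)
    ... | here refl = ⊥-elim (<-irrefl (sym x≡y) (All.lookup y< z∈))
    ... | there z∈′ = z∈′

<-ext : ∀ {a b} → (∀ {r} → r < a → r < b) → (∀ {r} → r < b → r < a) → a ≡ b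
<-ext a⊆b b⊆a = ≤-antisym (≮⇒≥ (λ b<a → <-irrefl refl (a⊆b b<a))) (≮⇒≥ (λ a<b → <-irrefl refl (b⊆a a<b)))

prefixLength : {P : ℕ → Set} → (∀ m → Dec (P m)) → ℕ → ℕ
prefixLength P? zero    = 0
prefixLength P? (suc K) with P? 0
... | yes _ = suc (prefixLength (P? ∘ suc) K)
... | no  _ = 0

prefixLength-sound : ∀ {P : ℕ → Set} (P? : ∀ m → Dec (P m)) K {r} → r < prefixLength P? K → P r
prefixLength-sound P? (suc K) {r} r< with P? 0
prefixLength-sound P? (suc K) {zero}  _        | yes p0 = p0
prefixLength-sound P? (suc K) {suc r} (s≤s r<) | yes _  = prefixLength-sound (P? ∘ suc) K r<

prefixLength-complete : ∀ {P : ℕ → Set} (P? : ∀ m → Dec (P m)) K →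
                        (∀ {r} → P (suc r) → P r) → (∀ {r} → P r → r < K) → ∀ {r} → P r → r < prefixLength P? K
prefixLength-complete P? zero    _    bound p = ⊥-elim (n≮0 (bound p))
prefixLength-complete {P} P? (suc K) down bound {r} p with P? 0
... | no ¬p0 = ⊥-elim (¬p0 (reach0 r p))
  where
  reach0 : ∀ r → P r → P 0
  reach0 zero    p = p
  reach0 (suc r) p = reach0 r (down p)
... | yes _ with r
...   | zero   = z<s
...   | suc r′ = s≤s (prefixLength-complete (P? ∘ suc) K down (λ q → ≤-pred (bound q)) p)

-- Height profiles

-- x is the entry just before l, and cap bounds the first entry of l.
Admissible : ℕ → ℕ → List ℕ → Set
Admissible x cap []      = ⊤
Admissible x cap (a ∷ l) = a ≤ cap × (0 < a → x ≡ 0) × Admissible a (suc x) l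

Staircase : List ℕ → Set
Staircase w = (∀ c → nth w (2 + c) ≤ suc (nth w c)) × (∀ c → 0 < nth w (suc c) → nth w c ≡ 0)

admissible⇒staircase : ∀ x cap l → Admissible x cap l → nth l 0 ≤ cap × Staircase (x ∷ l)
admissible⇒staircase x cap []      _ = z≤n , (λ _ → z≤n) , λ _ ()
admissible⇒staircase x cap (a ∷ l) (a≤cap , a>0⇒x≡0 , adm)
  with admissible⇒staircase a (suc x) l adm
... | b≤1+x , step , isolated = a≤cap , step′ , isolated′
  where
  step′ : ∀ c → nth (x ∷ a ∷ l) (2 + c) ≤ suc (nth (x ∷ a ∷ l) c)
  step′ zero    = b≤1+x
  step′ (suc c) = step c
  isolated′ : ∀ c → 0 < nth (x ∷ a ∷ l) (suc c) → nth (x ∷ a ∷ l) c ≡ 0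
  isolated′ zero    = a>0⇒x≡0
  isolated′ (suc c) = isolated c

staircase⇒admissible : ∀ x cap l → nth l 0 ≤ cap → Staircase (x ∷ l) → Admissible x cap l
staircase⇒admissible x cap []      _     _                  = tt
staircase⇒admissible x cap (a ∷ l) a≤cap (step , isolated) =
  a≤cap , isolated 0 , staircase⇒admissible a (suc x) l (step 0) (step ∘ suc , isolated ∘ suc)

-- Column 0 has height 0, and cap = 0 forces e₁ = 0.
Profile : List ℕ → Set
Profile = Admissible 0 0

height : List ℕ → ℕ → ℕ
height e = nth (0 ∷ e)

profile⇒staircase : ∀ {e} → Profile e → height e 1 ≡ 0 × Staircase (0 ∷ e)
profile⇒staircase {e} p with e₀≤0 , stairs ← admissible⇒staircase 0 0 e p = n≤0⇒n≡0 e₀≤0 , stairs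

height-bound : ∀ {e} → Profile e → ∀ c → 2 * height e c ≤ c
height-bound p zero = z≤n
height-bound p (suc zero) with h₁≡0 , _ ← profile⇒staircase p rewrite h₁≡0 = z≤n
height-bound {e} p (suc (suc c)) with _ , step , _ ← profile⇒staircase p = begin
  2 * height e (2 + c)      ≤⟨ *-monoʳ-≤ 2 (step c) ⟩
  2 * suc (height e c)      ≡⟨ *-suc 2 (height e c) ⟩
  2 + 2 * height e c        ≤⟨ +-monoʳ-≤ 2 (height-bound p c) ⟩
  2 + c                     ∎
  where open ≤-Reasoning

<height⇒2*< : ∀ {e r} → Profile e → ∀ c → r < height e c → 2 * r < c
<height⇒2*< p c r<h = <-≤-trans (*-monoʳ-< 2 r<h) (height-bound p c)

mutual
  admissibles : ℕ → ℕ → ℕ → List (List ℕ)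
  admissibles zero    x       cap = [ [] ]
  admissibles (suc m) (suc x) cap = map (0 ∷_) (admissibles m 0 (suc (suc x)))
  admissibles (suc m) zero    cap = branches m cap

  branches : ℕ → ℕ → List (List ℕ)
  branches m zero      = map (0 ∷_) (admissibles m 0 1)
  branches m (suc cap) = branches m cap ++ map (suc cap ∷_) (admissibles m (suc cap) 1)

∈-branches⁻ : ∀ m cap {l} → l ∈ branches m cap →
              ∃₂ λ a l′ → l ≡ a ∷ l′ × a ≤ cap × l′ ∈ admissibles m a 1
∈-branches⁻ m zero p with l′ , l′∈ , refl ← ∈-map⁻ (0 ∷_) p = 0 , l′ , refl , z≤n , l′∈
∈-branches⁻ m (suc cap) p with ∈-++⁻ (branches m cap) p
... | inj₁ q with a , l′ , eq , a≤ , l′∈ ← ∈-branches⁻ m cap q = a , l′ , eq , m≤n⇒m≤1+n a≤ , l′∈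
... | inj₂ q with l′ , l′∈ , refl ← ∈-map⁻ (suc cap ∷_) q = suc cap , l′ , refl , ≤-refl , l′∈

∈-branches⁺ : ∀ m cap {a l} → a ≤ cap → l ∈ admissibles m a 1 → a ∷ l ∈ branches m cap
∈-branches⁺ m zero      z≤n l∈ = ∈-map⁺ (0 ∷_) l∈
∈-branches⁺ m (suc cap) a≤ l∈ with m≤n⇒m<n∨m≡n a≤
... | inj₁ a<  = ∈-++⁺ˡ (∈-branches⁺ m cap (≤-pred a<) l∈)
... | inj₂ refl = ∈-++⁺ʳ (branches m cap) (∈-map⁺ (suc cap ∷_) l∈)

∈-admissibles⁻ : ∀ m x cap {l} → l ∈ admissibles m x cap → length l ≡ m × Admissible x cap l
∈-admissibles⁻ zero    x       cap (here refl) = refl , tt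
∈-admissibles⁻ (suc m) (suc x) cap p
  with l , l∈ , refl ← ∈-map⁻ (0 ∷_) p
  with len , adm ← ∈-admissibles⁻ m 0 (suc (suc x)) l∈ = cong suc len , z≤n , (λ ()) , adm
∈-admissibles⁻ (suc m) zero    cap p
  with a , l , refl , a≤ , l∈ ← ∈-branches⁻ m cap p
  with len , adm ← ∈-admissibles⁻ m a 1 l∈ = cong suc len , a≤ , (λ _ → refl) , adm

∈-admissibles⁺ : ∀ m x cap l → length l ≡ m → Admissible x cap l → l ∈ admissibles m x cap
∈-admissibles⁺ zero    x       cap []      _   _ = here refl
∈-admissibles⁺ (suc m) (suc x) cap (zero ∷ l) len (_ , _ , adm) =
  ∈-map⁺ (0 ∷_) (∈-admissibles⁺ m 0 (suc (suc x)) l (suc-injective len) adm)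
∈-admissibles⁺ (suc m) (suc x) cap (suc a ∷ l) len (_ , a>0⇒x≡0 , _) with () ← a>0⇒x≡0 z<s
∈-admissibles⁺ (suc m) zero    cap (a ∷ l) len (a≤ , _ , adm) =
  ∈-branches⁺ m cap a≤ (∈-admissibles⁺ m a 1 l (suc-injective len) adm)

mutual
  admissibles-unique : ∀ m x cap → Unique (admissibles m x cap)
  admissibles-unique zero    x       cap = All.[] AllPairs.∷ AllPairs.[]
  admissibles-unique (suc m) (suc x) cap = Unique.map⁺ ∷-injectiveʳ (admissibles-unique m 0 (suc (suc x)))
  admissibles-unique (suc m) zero    cap = branches-unique m cap

  branches-unique : ∀ m cap → Unique (branches m cap)
  branches-unique m zero      = Unique.map⁺ ∷-injectiveʳ (admissibles-unique m 0 1)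
  branches-unique m (suc cap) =
    Unique.++⁺ (branches-unique m cap) (Unique.map⁺ ∷-injectiveʳ (admissibles-unique m (suc cap) 1)) disjoint
    where
    disjoint : ∀ {l} → l ∈ branches m cap × l ∈ map (suc cap ∷_) (admissibles m (suc cap) 1) → ⊥
    disjoint (p , q) with ∈-branches⁻ m cap p | ∈-map⁻ (suc cap ∷_) q
    ... | _ , _ , refl , a≤cap , _ | _ , _ , refl = 1+n≰n a≤cap

C-sym : ∀ a b {n} → a + b ≡ n → n C a ≡ n C b
C-sym a b refl = trans (nCk≡nC[n∸k] (m≤m+n a b)) (cong ((a + b) C_) (m+n∸m≡n a b))

pascal : ∀ n k → n C suc k + n C k ≡ suc n C suc k
pascal n k = trans (+-comm (n C suc k) (n C k)) (nCk+nC[k+1]≡[n+1]C[k+1] n k)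

mutual
  length-admissibles : ∀ m cap → length (admissibles m 0 cap) ≡ (m + cap) C ⌈ m /2⌉
  length-admissibles zero    cap = refl
  length-admissibles (suc m) cap = length-branches m cap

  length-branches : ∀ m cap → length (branches m cap) ≡ (suc m + cap) C suc ⌊ m /2⌋
  length-branches m zero = begin
    length (map (0 ∷_) (admissibles m 0 1)) ≡⟨ length-map (0 ∷_) (admissibles m 0 1) ⟩
    length (admissibles m 0 1)              ≡⟨ length-admissibles m 1 ⟩
    (m + 1) C ⌈ m /2⌉                       ≡⟨ C-sym ⌈ m /2⌉ (suc ⌊ m /2⌋) halves ⟩
    (m + 1) C suc ⌊ m /2⌋                   ≡⟨ cong (_C suc ⌊ m /2⌋) (trans (+-comm m 1) (sym (+-identityʳ (suc m)))) ⟩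
    (suc m + 0) C suc ⌊ m /2⌋               ∎
    where
    open ≡-Reasoning
    halves : ⌈ m /2⌉ + suc ⌊ m /2⌋ ≡ m + 1
    halves = trans (+-comm ⌈ m /2⌉ (suc ⌊ m /2⌋)) (trans (cong suc (⌊n/2⌋+⌈n/2⌉≡n m)) (+-comm 1 m))
  length-branches m (suc cap) = begin
    length (branches m cap ++ map (suc cap ∷_) (admissibles m (suc cap) 1))
      ≡⟨ length-++ (branches m cap) ⟩
    length (branches m cap) + length (map (suc cap ∷_) (admissibles m (suc cap) 1))
      ≡⟨ cong₂ _+_ (length-branches m cap)
                   (trans (length-map (suc cap ∷_) (admissibles m (suc cap) 1)) (length-admissibles-after-nonzero m cap)) ⟩
    (suc m + cap) C suc ⌊ m /2⌋ + (m + suc cap) C ⌊ m /2⌋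
      ≡⟨ cong (λ n → (suc m + cap) C suc ⌊ m /2⌋ + n C ⌊ m /2⌋) (+-suc m cap) ⟩
    (suc m + cap) C suc ⌊ m /2⌋ + (suc m + cap) C ⌊ m /2⌋
      ≡⟨ pascal (suc m + cap) ⌊ m /2⌋ ⟩
    suc (suc m + cap) C suc ⌊ m /2⌋
      ≡⟨ cong (_C suc ⌊ m /2⌋) (sym (+-suc (suc m) cap)) ⟩
    (suc m + suc cap) C suc ⌊ m /2⌋ ∎
    where open ≡-Reasoning

  length-admissibles-after-nonzero : ∀ m c → length (admissibles m (suc c) 1) ≡ (m + suc c) C ⌊ m /2⌋
  length-admissibles-after-nonzero zero    c = refl
  length-admissibles-after-nonzero (suc m) c = begin
    length (map (0 ∷_) (admissibles m 0 (suc (suc c)))) ≡⟨ length-map (0 ∷_) (admissibles m 0 (suc (suc c))) ⟩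
    length (admissibles m 0 (suc (suc c)))              ≡⟨ length-admissibles m (suc (suc c)) ⟩
    (m + suc (suc c)) C ⌈ m /2⌉                        ≡⟨ cong (_C ⌈ m /2⌉) (+-suc m (suc c)) ⟩
    (suc m + suc c) C ⌈ m /2⌉                          ∎
    where open ≡-Reasoning

profiles : ℕ → List (List ℕ)
profiles n = admissibles n 0 0

length-profiles : ∀ k → length (profiles (2 * k)) ≡ (2 * k) C k
length-profiles k = begin
  length (admissibles (2 * k) 0 0) ≡⟨ length-admissibles (2 * k) 0 ⟩
  (2 * k + 0) C ⌈ 2 * k /2⌉        ≡⟨ cong₂ _C_ (+-identityʳ (2 * k)) ⌈2k/2⌉≡k ⟩
  (2 * k) C k                      ∎
  where
  open ≡-Reasoning
  ⌈2k/2⌉≡k : ⌈ 2 * k /2⌉ ≡ k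
  ⌈2k/2⌉≡k = sym (trans (n≡⌈n+n/2⌉ k) (cong (λ n → ⌈ k + n /2⌉) (sym (+-identityʳ k))))

-- Numerical semigroups

module _ {s t : ℕ} where

  ≼⇒representable-gap : ∀ {y x} → y ≼⟨ s , t ⟩ x → ∃[ g ] (x ≡ y + g × Representable s t g)
  ≼⇒representable-gap {y} ε = 0 , sym (+-identityʳ y) , 0 , 0 , refl
  ≼⇒representable-gap {y} ((_ , _ , y+δ) ◅ z≼x) with ≼⇒representable-gap z≼x | y+δ
  ... | g , refl , a , b , refl | inj₁ refl = s + g , +-assoc y s g , suc a , b , +-assoc s (a * s) (b * t)
  ... | g , refl , a , b , refl | inj₂ refl = t + g , +-assoc y t g , a , suc b , shuffle a s b t
    where
    shuffle : ∀ a s b t → a * s + (t + b * t) ≡ t + (a * s + b * t)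
    shuffle = solve-∀

  InP-below : ∀ {y g x} → 1 ≤ y → Representable s t g → x ≡ y + g → InP s t x → InP s t y
  InP-below {y} 1≤y (a , b , refl) refl (_ , ¬rep) =
    1≤y , λ (a′ , b′ , eq) → ¬rep (a′ + a , b′ + b , trans (split a′ a b′ b s t) (cong (_+ (a * s + b * t)) eq))
    where
    split : ∀ a′ a b′ b s t → (a′ + a) * s + (b′ + b) * t ≡ (a′ * s + b′ * t) + (a * s + b * t)
    split = solve-∀

  representable-gap⇒≼ : ∀ a b {y x} → 1 ≤ y → InP s t x → x ≡ y + (a * s + b * t) → y ≼⟨ s , t ⟩ x
  representable-gap⇒≼ zero zero {y} _ _ refl = subst (y ≼⟨ s , t ⟩_) (sym (+-identityʳ y)) ε
  representable-gap⇒≼ (suc a) b {y} {x} 1≤y x∈P eq =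
    (InP-below 1≤y+s (a , b , refl) eq′ x∈P , InP-below 1≤y (suc a , b , refl) eq x∈P , inj₁ refl)
      ◅ representable-gap⇒≼ a b 1≤y+s x∈P eq′
    where
    1≤y+s : 1 ≤ y + s
    1≤y+s = ≤-trans 1≤y (m≤m+n y s)
    eq′ : x ≡ y + s + (a * s + b * t)
    eq′ = trans eq (shift y s a b t)
      where
      shift : ∀ y s a b t → y + ((s + a * s) + b * t) ≡ y + s + (a * s + b * t)
      shift = solve-∀
  representable-gap⇒≼ zero (suc b) {y} {x} 1≤y x∈P eq =
    (InP-below 1≤y+t (0 , b , refl) eq′ x∈P , InP-below 1≤y (0 , suc b , refl) eq x∈P , inj₂ refl)
      ◅ representable-gap⇒≼ 0 b 1≤y+t x∈P eq′
    where
    1≤y+t : 1 ≤ y + t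
    1≤y+t = ≤-trans 1≤y (m≤m+n y t)
    eq′ : x ≡ y + t + (0 * s + b * t)
    eq′ = trans eq (shift y t b)
      where
      shift : ∀ y t b → y + (t + b * t) ≡ y + t + b * t
      shift = solve-∀

-- Division with remainder

divMod-minimal : ∀ {s} r q {c e} → c < s → r * s + c ≡ q * s + e → q ≤ r × c ≤ e
divMod-minimal {s} r q {c} {e} c<s eq = q≤r , c≤e
  where
  open ≤-Reasoning
  q≤r : q ≤ r
  q≤r = ≤-pred (*-cancelʳ-< s q (suc r) (begin-strict
    q * s      ≤⟨ m≤m+n (q * s) e ⟩
    q * s + e  ≡⟨ sym eq ⟩
    r * s + c  <⟨ +-monoʳ-< (r * s) c<s ⟩
    r * s + s  ≡⟨ +-comm (r * s) s ⟩
    suc r * s  ∎))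
  c≤e : c ≤ e
  c≤e = +-cancelˡ-≤ (q * s) c e (begin
    q * s + c  ≤⟨ +-monoˡ-≤ c (*-monoˡ-≤ s q≤r) ⟩
    r * s + c  ≡⟨ eq ⟩
    q * s + e  ∎)

divMod-unique : ∀ {s} r r′ {c c′} → c < s → c′ < s → r * s + c ≡ r′ * s + c′ → r ≡ r′ × c ≡ c′
divMod-unique r r′ c<s c′<s eq with divMod-minimal r r′ c<s eq | divMod-minimal r′ r c′<s (sym eq)
... | r′≤r , c≤c′ | r≤r′ , c′≤c = ≤-antisym r≤r′ r′≤r , ≤-antisym c≤c′ c′≤c

divMod-decomposition : ∀ {s} .{{_ : NonZero s}} x → x ≡ x / s * s + x % s
divMod-decomposition {s} x = trans (m≡m%n+[m/n]*n x s) (+-comm (x % s) _)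

divMod-of : ∀ {s} .{{_ : NonZero s}} r {c} → c < s → (r * s + c) / s ≡ r × (r * s + c) % s ≡ c
divMod-of {s} r {c} c<s =
  divMod-unique ((r * s + c) / s) r (m%n<n (r * s + c) s) c<s (sym (divMod-decomposition (r * s + c)))

remainder≤2*quotient : ∀ {s} r q {c e} → c < s → e ≤ 2 * q → r * s + c ≡ q * s + e → c ≤ 2 * r
remainder≤2*quotient r q c<s e≤2q eq with q≤r , c≤e ← divMod-minimal r q c<s eq =
  ≤-trans c≤e (≤-trans e≤2q (*-monoʳ-≤ 2 q≤r))

cell<s*s : ∀ {s} r {c} → 2 * r < c → c < s → r * s + c < s * s
cell<s*s {s} r {c} 2r<c c<s = begin-strict
  r * s + c  <⟨ +-monoʳ-< (r * s) c<s ⟩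
  r * s + s  ≡⟨ +-comm (r * s) s ⟩
  suc r * s  ≤⟨ *-monoˡ-≤ s (≤-trans (s≤s (≤-trans (m≤n*m r 2) (<⇒≤ 2r<c))) c<s) ⟩
  s * s      ∎
  where open ≤-Reasoning

-- A carry past s would leave a remainder of at most 1, while 2 r < c.
carry-free : ∀ {s} r q {c e} → 2 * r < c → c < s → r * s + c ≡ q * s + e → e < 2 + s → e < s
carry-free {s} r q {c} {e} 2r<c c<s eq e<2+s = ≰⇒> no-carry
  where
  open ≤-Reasoning
  carry : ∀ q s d → q * s + (s + d) ≡ suc q * s + d
  carry = solve-∀
  no-carry : ¬ s ≤ e
  no-carry s≤e with d , refl ← m≤n⇒∃[o]m+o≡n s≤e
    with 1+q≤r , c≤d ← divMod-minimal r (suc q) c<s (trans eq (carry q s d)) = <-irrefl refl (begin-strict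
    2      ≤⟨ *-monoʳ-≤ 2 (≤-trans (s≤s z≤n) 1+q≤r) ⟩
    2 * r  <⟨ 2r<c ⟩
    c      ≤⟨ c≤d ⟩
    d      <⟨ +-cancelˡ-< s d 2 (subst (s + d <_) (+-comm 2 s) e<2+s) ⟩
    2      ∎)

even-or-odd : ∀ n → ∃[ b ] (n ≡ 2 * b ⊎ n ≡ suc (2 * b))
even-or-odd zero = 0 , inj₁ refl
even-or-odd (suc n) with even-or-odd n
... | b , inj₁ refl = b , inj₂ refl
... | b , inj₂ refl = suc b , inj₁ (cong suc (sym (+-suc b (b + 0))))

-- M_{s,s+2} in quotient–remainder coordinates

triangle⇒InP : ∀ {s t} r {c} → t ≡ 2 + s → 2 * r < c → c < s → InP s t (r * s + c)
triangle⇒InP {s} r {c} refl 2r<c c<s = ≤-trans (≤-trans (s≤s z≤n) 2r<c) (m≤n+m c (r * s)) , ¬rep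
  where
  regroup : ∀ a b s → a * s + b * (2 + s) ≡ (a + b) * s + 2 * b
  regroup = solve-∀
  ¬rep : ¬ Representable s (2 + s) (r * s + c)
  ¬rep (a , b , eq) =
    <⇒≱ 2r<c (remainder≤2*quotient r (a + b) c<s (*-monoʳ-≤ 2 (m≤n+m b a)) (trans (sym eq) (regroup a b s)))

triangle⇒¬above : ∀ {s t} r {c} → t ≡ 2 + s → 2 * r < c → c < s → ¬ (suc s ≼⟨ s , t ⟩ (r * s + c))
triangle⇒¬above {s} r {c} refl 2r<c c<s 1+s≼x with _ , eq , a , b , refl ← ≼⇒representable-gap 1+s≼x =
  <⇒≱ 2r<c (remainder≤2*quotient r (suc (a + b)) c<s odd≤ (trans eq (regroup a b s)))
  where
  odd≤ : suc (2 * b) ≤ 2 * suc (a + b)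
  odd≤ = ≤-trans (s≤s (≤-trans (*-monoʳ-≤ 2 (m≤n+m b a)) (n≤1+n _))) (≤-reflexive (sym (*-suc 2 (a + b))))
  regroup : ∀ a b s → suc s + (a * s + b * (2 + s)) ≡ suc (a + b) * s + suc (2 * b)
  regroup = solve-∀

-- An even c = 2 b gives x = (q − b) s + b t, an odd c = 2 b + 1 gives x = (s + 1) + (q − b − 1) s + b t.
diagonal-split : ∀ {s} q c → c ≤ 2 * q →
                 Representable s (2 + s) (q * s + c) ⊎ ∃₂ λ a b → q * s + c ≡ suc s + (a * s + b * (2 + s))
diagonal-split {s} q c c≤2q with even-or-odd c
... | b , inj₁ refl with a , refl ← m≤n⇒∃[o]m+o≡n (*-cancelˡ-≤ {b} {q} 2 c≤2q) = inj₁ (a , b , regroup b a s)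
  where
  regroup : ∀ b a s → a * s + b * (2 + s) ≡ (b + a) * s + 2 * b
  regroup = solve-∀
... | b , inj₂ refl with a , refl ← m≤n⇒∃[o]m+o≡n (*-cancelˡ-< 2 b q c≤2q) = inj₂ (a , b , regroup b a s)
  where
  regroup : ∀ b a s → (suc b + a) * s + suc (2 * b) ≡ suc s + (a * s + b * (2 + s))
  regroup = solve-∀

InP∧¬above⇒triangle : ∀ {s t x} .{{_ : NonZero s}} → t ≡ 2 + s →
                      InP s t x → ¬ (suc s ≼⟨ s , t ⟩ x) → 2 * (x / s) < x % s
InP∧¬above⇒triangle {s} {x = x} refl x∈P@(_ , ¬rep) ¬above with 2 * (x / s) <? x % s
... | yes 2q<c = 2q<c
... | no 2q≮c with diagonal-split (x / s) (x % s) (≮⇒≥ 2q≮c)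
...   | inj₁ rep          = ⊥-elim (¬rep (subst (Representable s (2 + s)) (sym (divMod-decomposition x)) rep))
...   | inj₂ (a , b , eq) = ⊥-elim (¬above (representable-gap⇒≼ a b (s≤s z≤n) x∈P (trans (divMod-decomposition x) eq)))

-- Nice order ideals as staircases

module Ideals (k : ℕ) where

  n s t : ℕ
  n = 2 * k
  s = 2 * k + 1
  t = 2 * k + 3

  s≡1+n : s ≡ suc n
  s≡1+n = +-comm (2 * k) 1

  t≡2+s : t ≡ 2 + s
  t≡2+s = lemma k
    where
    lemma : ∀ k → 2 * k + 3 ≡ 2 + (2 * k + 1)
    lemma = solve-∀

  u≡1+s : 2 * k + 2 ≡ suc s
  u≡1+s = lemma k
    where
    lemma : ∀ k → 2 * k + 2 ≡ suc (2 * k + 1)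
    lemma = solve-∀

  instance
    s-nonZero : NonZero s
    s-nonZero = >-nonZero (subst (0 <_) (sym s≡1+n) z<s)

  InM⇒cell : ∀ {x} → InM k x → 2 * (x / s) < x % s
  InM⇒cell {x} (x∈P , ¬above) = InP∧¬above⇒triangle t≡2+s x∈P (¬above ∘ subst (_≼⟨ s , t ⟩ x) (sym u≡1+s))

  cell⇒InM : ∀ r {c} → 2 * r < c → c < s → InM k (r * s + c)
  cell⇒InM r {c} 2r<c c<s =
    triangle⇒InP r t≡2+s 2r<c c<s , triangle⇒¬above r t≡2+s 2r<c c<s ∘ subst (_≼⟨ s , t ⟩ (r * s + c)) u≡1+s

  InM-cell : ∀ r {c} → c < s → InM k (r * s + c) → 2 * r < c
  InM-cell r {c} c<s x∈M with r≡ , c≡ ← divMod-of r c<s = subst₂ (λ q e → 2 * q < e) r≡ c≡ (InM⇒cell x∈M)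

  cover-coordinates : ∀ r r′ {c c′} → 2 * r < c → c < s → c′ < s →
                      (r * s + c ≡ r′ * s + c′ + s) ⊎ (r * s + c ≡ r′ * s + c′ + t) →
                      r ≡ suc r′ × (c ≡ c′ ⊎ c ≡ 2 + c′)
  cover-coordinates r r′ {c} {c′} 2r<c c<s c′<s (inj₁ eq) =
    map₂ inj₁ (divMod-unique r (suc r′) c<s c′<s (trans eq (shift r′ s c′)))
    where
    shift : ∀ r′ s c′ → r′ * s + c′ + s ≡ suc r′ * s + c′
    shift = solve-∀
  cover-coordinates r r′ {c} {c′} 2r<c c<s c′<s (inj₂ eq) =
    map₂ inj₂ (divMod-unique r (suc r′) c<s (carry-free r (suc r′) 2r<c c<s eq′ (+-monoʳ-< 2 c′<s)) eq′)
    where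
    shift : ∀ r′ s c′ → r′ * s + c′ + (2 + s) ≡ suc r′ * s + (2 + c′)
    shift = solve-∀
    eq′ : r * s + c ≡ suc r′ * s + (2 + c′)
    eq′ = trans eq (trans (cong (r′ * s + c′ +_) t≡2+s) (shift r′ s c′))

  successor-coordinates : ∀ r r′ {c c′} → 2 * r < c → c < s → c′ < s →
                          r * s + c ≡ r′ * s + c′ + 1 → r ≡ r′ × c ≡ suc c′
  successor-coordinates r r′ {c} {c′} 2r<c c<s c′<s eq =
    divMod-unique r r′ c<s (carry-free r r′ 2r<c c<s eq′ (<-trans (s≤s c′<s) (n<1+n (suc s)))) eq′
    where
    eq′ : r * s + c ≡ r′ * s + suc c′
    eq′ = trans eq (trans (+-assoc (r′ * s) c′ 1) (cong (r′ * s +_) (+-comm c′ 1)))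

  in-coordinates : ∀ {x y d} → x ≡ y + d → x / s * s + x % s ≡ y / s * s + y % s + d
  in-coordinates {x} {y} {d} eq = trans (sym (divMod-decomposition x)) (trans eq (cong (_+ d) (divMod-decomposition y)))

  InM⇒<s*s : ∀ {x} → InM k x → x < s * s
  InM⇒<s*s {x} x∈M = subst (_< s * s) (sym (divMod-decomposition x)) (cell<s*s (x / s) (InM⇒cell x∈M) (m%n<n x s))

  idealOf : List ℕ → List ℕ
  idealOf e = filter (λ x → x / s <? height e (x % s)) (upTo (s * s))

  ∈-idealOf⇔ : ∀ {e x} → x ∈ idealOf e ⇔ (x < s * s × x / s < height e (x % s))
  ∈-idealOf⇔ {e} = mk⇔ (λ x∈ → map₁ ∈-upTo⁻ (∈-filter⁻ (λ x → x / s <? height e (x % s)) x∈))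
                       (λ (x< , q<h) → ∈-filter⁺ (λ x → x / s <? height e (x % s)) (∈-upTo⁺ x<) q<h)

  idealOf-linked : ∀ e → Linked _<_ (idealOf e)
  idealOf-linked e =
    Linked.filter⁺ (λ x → x / s <? height e (x % s)) <-trans (Linked.applyUpTo⁺₂ id (s * s) (λ i → n<1+n i))

  cell∈idealOf⇔ : ∀ {e r c} → Profile e → c < s → r * s + c ∈ idealOf e ⇔ r < height e c
  cell∈idealOf⇔ {e} {r} {c} p c<s with r≡ , c≡ ← divMod-of r c<s = mk⇔
    (λ x∈ → subst₂ (λ q c → q < height e c) r≡ c≡ (proj₂ (Equivalence.to ∈-idealOf⇔ x∈)))
    (λ r<h → Equivalence.from ∈-idealOf⇔
      (cell<s*s r (<height⇒2*< p c r<h) c<s , subst₂ (λ q c → q < height e c) (sym r≡) (sym c≡) r<h))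

  module _ {e} (p : Profile e) where

    ∈idealOf⇒diagonal : ∀ {x} → x ∈ idealOf e → 2 * (x / s) < x % s
    ∈idealOf⇒diagonal {x} x∈ = <height⇒2*< p (x % s) (proj₂ (Equivalence.to ∈-idealOf⇔ x∈))

    idealOf⊆M : ∀ {x} → x ∈ idealOf e → InM k x
    idealOf⊆M {x} x∈ =
      subst (InM k) (sym (divMod-decomposition x)) (cell⇒InM (x / s) (∈idealOf⇒diagonal x∈) (m%n<n x s))

    idealOf-cover-closed : ∀ {x y} → x ∈ idealOf e → (x ≡ y + s ⊎ x ≡ y + t) → y ∈ idealOf e
    idealOf-cover-closed {x} {y} x∈ cover
      with x<s*s , q<h ← Equivalence.to ∈-idealOf⇔ x∈
      with r≡ , c≡ ← cover-coordinates (x / s) (y / s) (∈idealOf⇒diagonal x∈) (m%n<n x s) (m%n<n y s)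
                                       (Sum.map in-coordinates in-coordinates cover)
      = Equivalence.from ∈-idealOf⇔ (≤-<-trans (lower cover) x<s*s , below c≡)
      where
      lower : (x ≡ y + s ⊎ x ≡ y + t) → y ≤ x
      lower (inj₁ refl) = m≤m+n y s
      lower (inj₂ refl) = m≤m+n y t
      1+q′<h : suc (y / s) < height e (x % s)
      1+q′<h = subst (_< height e (x % s)) r≡ q<h
      below : x % s ≡ y % s ⊎ x % s ≡ 2 + y % s → y / s < height e (y % s)
      below (inj₁ c≡c′)  = <-trans (n<1+n (y / s)) (subst (λ c → suc (y / s) < height e c) c≡c′ 1+q′<h)
      below (inj₂ c≡2+c′) = ≤-pred (<-≤-trans (subst (λ c → suc (y / s) < height e c) c≡2+c′ 1+q′<h)
                                               (proj₁ (proj₂ (profile⇒staircase p)) (y % s)))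

    idealOf-≼-closed : ∀ {x y} → x ∈ idealOf e → InM k y → y ≼⟨ s , t ⟩ x → y ∈ idealOf e
    idealOf-≼-closed x∈ y∈M ε = x∈
    idealOf-≼-closed x∈ y∈M ((z∈P , _ , cover) ◅ z≼x) =
      idealOf-cover-closed (idealOf-≼-closed x∈ (z∈P , λ u≼z → proj₂ (idealOf⊆M x∈) (u≼z ◅◅ z≼x)) z≼x) cover

    idealOf-nice : IsNice (idealOf e)
    idealOf-nice {x} {y} x∈ y∈ x≡y+1
      with r≡ , c≡ ← successor-coordinates (x / s) (y / s) (∈idealOf⇒diagonal x∈) (m%n<n x s) (m%n<n y s)
                                           (in-coordinates x≡y+1) =
      <⇒≢ (≤-<-trans z≤n (proj₂ (Equivalence.to ∈-idealOf⇔ y∈)))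
          (sym (proj₂ (proj₂ (profile⇒staircase p)) (y % s) 0<h))
      where
      0<h : 0 < height e (suc (y % s))
      0<h = ≤-<-trans z≤n (subst (λ c → x / s < height e c) c≡ (proj₂ (Equivalence.to ∈-idealOf⇔ x∈)))

    -- 1 could only sit in column 1, which is empty.
    1∉idealOf : 1 ∉ idealOf e
    1∉idealOf 1∈ with c≡1 ← ≤-antisym (m%n≤m 1 s) (≤-trans (s≤s z≤n) (∈idealOf⇒diagonal 1∈)) =
      n≮0 (subst (1 / s <_) (trans (cong (height e) c≡1) (proj₁ (profile⇒staircase p)))
                 (proj₂ (Equivalence.to ∈-idealOf⇔ 1∈)))

    idealOf-counted : Counted k (idealOf e)
    idealOf-counted = (idealOf-linked e , idealOf⊆M , idealOf-≼-closed) , idealOf-nice , 1∉idealOf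

  column : List ℕ → ℕ → ℕ
  column I c = prefixLength (λ r → r * s + c ∈? I) s

  profileOf : List ℕ → List ℕ
  profileOf I = applyUpTo (λ i → column I (suc i)) n

  length-profileOf : ∀ I → length (profileOf I) ≡ n
  length-profileOf I = length-applyUpTo (λ i → column I (suc i)) n

  height-profileOf : ∀ I {i} → i < n → height (profileOf I) (suc i) ≡ column I (suc i)
  height-profileOf I = nth-applyUpTo (λ i → column I (suc i)) n

  <height-profileOf⇒column<s : ∀ I {r c} → r < height (profileOf I) c → c < s
  <height-profileOf⇒column<s I {c = zero}  _   = subst (0 <_) (sym s≡1+n) z<s
  <height-profileOf⇒column<s I {c = suc i} r<h with i <? n
  ... | yes i<n = subst (suc i <_) (sym s≡1+n) (s≤s i<n)
  ... | no  i≮n =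
    ⊥-elim (n≮0 (subst (_ <_) (nth-beyond (profileOf I) (≤-trans (≤-reflexive (length-profileOf I)) (≮⇒≥ i≮n))) r<h))

  module _ {I} (I-counted : Counted k I) where

    private
      I-linked : Linked _<_ I
      I-linked = proj₁ (proj₁ I-counted)
      ⊆M : ∀ {x} → x ∈ I → InM k x
      ⊆M = proj₁ (proj₂ (proj₁ I-counted))
      ≼-closed : ∀ {x y} → x ∈ I → InM k y → y ≼⟨ s , t ⟩ x → y ∈ I
      ≼-closed = proj₂ (proj₂ (proj₁ I-counted))
      I-nice : IsNice I
      I-nice = proj₁ (proj₂ I-counted)
      1∉I : 1 ∉ I
      1∉I = proj₂ (proj₂ I-counted)

    cover-∈ : ∀ {x y} → x ∈ I → InM k y → (x ≡ y + s ⊎ x ≡ y + t) → y ∈ I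
    cover-∈ x∈ y∈M cover = ≼-closed x∈ y∈M ((proj₁ (⊆M x∈) , proj₁ y∈M , cover) ◅ ε)

    <height⇒∈ : ∀ {r c} → r < height (profileOf I) c → r * s + c ∈ I
    <height⇒∈ {r} {suc i} r<h =
      prefixLength-sound (λ r → r * s + suc i ∈? I) s (subst (r <_) (height-profileOf I i<n) r<h)
      where
      i<n : i < n
      i<n = ≤-pred (subst (suc i <_) s≡1+n (<height-profileOf⇒column<s I r<h))

    ∈⇒<height : ∀ {r c} → c < s → r * s + c ∈ I → r < height (profileOf I) c
    ∈⇒<height {r} {zero}  c<s x∈ = ⊥-elim (n≮0 (InM-cell r c<s (⊆M x∈)))
    ∈⇒<height {r} {suc i} c<s x∈ =
      subst (r <_) (sym (height-profileOf I (≤-pred (subst (suc i <_) s≡1+n c<s))))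
        (prefixLength-complete (λ r → r * s + suc i ∈? I) s (λ {r} → down {r}) bound {r} x∈)
      where
      down : ∀ {r} → suc r * s + suc i ∈ I → r * s + suc i ∈ I
      down {r} x∈ =
        cover-∈ x∈ (cell⇒InM r (<-trans (*-monoʳ-< 2 (n<1+n r)) (InM-cell (suc r) c<s (⊆M x∈))) c<s) (inj₁ (shift r s (suc i)))
        where
        shift : ∀ r s c → suc r * s + c ≡ r * s + c + s
        shift = solve-∀
      bound : ∀ {r} → r * s + suc i ∈ I → r < s
      bound {r} x∈ = ≤-<-trans (m≤n*m r 2) (<-trans (InM-cell r c<s (⊆M x∈)) c<s)

    profileOf-profile : Profile (profileOf I)
    profileOf-profile = staircase⇒admissible 0 0 (profileOf I) first-empty (step , isolated)
      where
      h : ℕ → ℕ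
      h = height (profileOf I)
      first-empty : h 1 ≤ 0
      first-empty = ≮⇒≥ (λ 0<h₁ → 1∉I (<height⇒∈ {0} {1} 0<h₁))
      -- A cell h c + 1 in column c + 2 would cover the cell (h c, c), just above column c.
      no-gap : ∀ c → ¬ suc (h c) < h (2 + c)
      no-gap c 1+h<h = <-irrefl refl (∈⇒<height c<s (cover-∈ upper∈ (cell⇒InM (h c) 2h<c c<s) (inj₂ (shift (h c) c))))
        where
        upper∈ : suc (h c) * s + (2 + c) ∈ I
        upper∈ = <height⇒∈ 1+h<h
        2+c<s : 2 + c < s
        2+c<s = <height-profileOf⇒column<s I 1+h<h
        c<s : c < s
        c<s = <-trans (≤-<-trans (n≤1+n c) (n<1+n (suc c))) 2+c<s
        2h<c : 2 * h c < c
        2h<c = ≤-pred (≤-pred (subst (_< 2 + c) (*-suc 2 (h c)) (InM-cell (suc (h c)) 2+c<s (⊆M upper∈))))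
        shift : ∀ r c → suc r * s + (2 + c) ≡ r * s + c + t
        shift r c = trans (regroup r s c) (cong (r * s + c +_) (sym t≡2+s))
          where
          regroup : ∀ r s c → suc r * s + (2 + c) ≡ r * s + c + (2 + s)
          regroup = solve-∀
      step : ∀ c → h (2 + c) ≤ suc (h c)
      step c = ≮⇒≥ (no-gap c)
      isolated : ∀ c → 0 < h (suc c) → h c ≡ 0
      isolated c 0<h₁₊c =
        n≤0⇒n≡0 (≮⇒≥ λ 0<hc → I-nice (<height⇒∈ {0} {suc c} 0<h₁₊c) (<height⇒∈ {0} {c} 0<hc) (+-comm 1 c))

    idealOf-profileOf : idealOf (profileOf I) ≡ I
    idealOf-profileOf = Linked<-ext (idealOf-linked (profileOf I)) I-linked (mk⇔ ⊆I ⊇I)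
      where
      ⊆I : ∀ {x} → x ∈ idealOf (profileOf I) → x ∈ I
      ⊆I {x} x∈ = subst (_∈ I) (sym (divMod-decomposition x)) (<height⇒∈ (proj₂ (Equivalence.to ∈-idealOf⇔ x∈)))
      ⊇I : ∀ {x} → x ∈ I → x ∈ idealOf (profileOf I)
      ⊇I {x} x∈ = Equivalence.from ∈-idealOf⇔
        (InM⇒<s*s (⊆M x∈) , ∈⇒<height (m%n<n x s) (subst (_∈ I) (divMod-decomposition x) x∈))

  profileOf-idealOf : ∀ {e} → Profile e → length e ≡ n → profileOf (idealOf e) ≡ e
  profileOf-idealOf {e} p len =
    nth-ext (profileOf (idealOf e)) e (trans (length-profileOf (idealOf e)) (sym len)) same-height
    where
    same-height : ∀ i → height (profileOf (idealOf e)) (suc i) ≡ height e (suc i)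
    same-height i with suc i <? s
    ... | yes c<s = <-ext (λ r<h → Equivalence.to (cell∈idealOf⇔ p c<s) (<height⇒∈ (idealOf-counted p) r<h))
                          (λ r<h → ∈⇒<height (idealOf-counted p) c<s (Equivalence.from (cell∈idealOf⇔ p c<s) r<h))
    ... | no c≮s =
      trans (nth-beyond (profileOf (idealOf e)) (≤-trans (≤-reflexive (length-profileOf (idealOf e))) n≤i))
            (sym (nth-beyond e (≤-trans (≤-reflexive len) n≤i)))
      where
      n≤i : n ≤ i
      n≤i = ≤-pred (subst (_≤ suc i) s≡1+n (≮⇒≥ c≮s))

  idealsOf : List (List ℕ)
  idealsOf = map idealOf (profiles n)

  idealsOf-unique : Unique idealsOf
  idealsOf-unique = Unique.map⁻ {f = profileOf} (subst Unique (sym retraction) (admissibles-unique n 0 0))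
    where
    retraction : map profileOf idealsOf ≡ profiles n
    retraction = trans (sym (map-∘ (profiles n))) (map-id-local (All.tabulate λ e∈ →
      let len , p = ∈-admissibles⁻ n 0 0 e∈ in profileOf-idealOf p len))

  length-idealsOf : length idealsOf ≡ n C k
  length-idealsOf = trans (length-map idealOf (profiles n)) (length-profiles k)

  ∈-idealsOf⇔ : ∀ I → I ∈ idealsOf ⇔ Counted k I
  ∈-idealsOf⇔ I = mk⇔ ⇒counted ⇐counted
    where
    ⇒counted : I ∈ idealsOf → Counted k I
    ⇒counted I∈ with e , e∈ , refl ← ∈-map⁻ idealOf I∈ = idealOf-counted (proj₂ (∈-admissibles⁻ n 0 0 e∈))
    ⇐counted : Counted k I → I ∈ idealsOf
    ⇐counted I-counted = subst (_∈ idealsOf) (idealOf-profileOf I-counted)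
      (∈-map⁺ idealOf (∈-admissibles⁺ n 0 0 (profileOf I) (length-profileOf I) (profileOf-profile I-counted)))

lemma4 : (k : ℕ) → ∃[ L ] (Unique L × length L ≡ (2 * k) C k
    × (∀ (I : List ℕ) → (I ∈ L) ⇔ Counted k I))
lemma4 k = idealsOf , idealsOf-unique , length-idealsOf , ∈-idealsOf⇔
  where open Ideals k
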